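{- Let $f:[1\,.\,.\,n]\to\{0,1\}$ and let $X = f(1)f(2)\cdots f(n)$ be the binary string whose $i$-th character is $f(i)$. If $X$ contains $|S|\ge 0$ ones, where $S=\{i\in[1\,.\,.\,n]: f(i)=1\}$, then the LZ77 factorization of $X$ has size $z \leq 3|S| + 2$.
   Context: LZ77 factorization: greedy left-to-right parsing where each phrase starting at position $i$ is the longest fragment $X[i\,.\,.\,i+\ell)$ equal to $X[i'\,.\,.\,i'+\ell)$ for some $i'<i$ (overlaps allowed), or the single character $X[i]$ if no such nonempty fragment exists; $z$ is the number of phrases. -}

module Defs where

open import Data.Nat using (ℕ; zero; suc; _+_; _<_; _≤_)
open import Data.Bool using (Bool; true; false; if_then_else_)
open import Data.Fin using (Fin; fromℕ<)
open import Data.List using (map; allFin)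
open import Data.Nat.ListAction using (sum)
open import Data.Product using (Σ; ∃; _×_)
open import Data.Sum using (_⊎_)
open import Relation.Nullary using (¬_)
open import Relation.Binary.PropositionalEquality using (_≡_)

-- A string of length n over {0,1} is a function X : Fin n → Bool
-- (true = 1, false = 0); positions are 0-based: X[0 .. n).

-- The fragment X[i .. i+ℓ) (lying inside X) equals X[i' .. i'+ℓ) for some i' < i
-- (overlaps allowed).
PrevOcc : ∀ {n} → (Fin n → Bool) → ℕ → ℕ → Set
PrevOcc {n} X i ℓ =
  (i + ℓ ≤ n) ×
  Σ ℕ (λ i' → (i' < i) ×
    (∀ k → k < ℓ → (p : i' + k < n) → (q : i + k < n) →
       X (fromℕ< p) ≡ X (fromℕ< q)))

LZPhrase : ∀ {n} → (Fin n → Bool) → ℕ → ℕ → Set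
LZPhrase {n} X i ℓ =
  (i < n) ×
  ( (1 ≤ ℓ × PrevOcc X i ℓ × (∀ m → PrevOcc X i m → m ≤ ℓ))
  ⊎ (ℓ ≡ 1 × (∀ m → 1 ≤ m → ¬ PrevOcc X i m)) )

data LZ77 {n : ℕ} (X : Fin n → Bool) : ℕ → ℕ → Set where
  lz-end  : LZ77 X n 0
  lz-step : ∀ {i ℓ z} → LZPhrase X i ℓ → LZ77 X (i + ℓ) z → LZ77 X i (suc z)

LZ77Size : ∀ {n} → (Fin n → Bool) → ℕ → Set
LZ77Size X z = LZ77 X 0 z

ones : ∀ {n} → (Fin n → Bool) → ℕ
ones {n} f = sum (map (λ i → if f i then 1 else 0) (allFin n))

{-# OPTIONS --safe #-}
module Submission where

open import Defs
open import Data.Nat using (ℕ; _+_; _*_; _≤_)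
open import Data.Bool using (Bool)
open import Data.Fin using (Fin)

open import Data.Nat using (zero; suc; _∸_; _<_; z≤n; s≤s; _<?_)
open import Data.Nat.Properties
open import Data.Bool using (true; false; if_then_else_)
open import Data.Fin using (fromℕ<; toℕ)
open import Data.Fin.Properties using (toℕ<n; fromℕ<-toℕ)
open import Data.List using (tabulate)
open import Data.List.Properties using (map-tabulate)
open import Data.Nat.ListAction using (sum)
open import Data.Product using (_,_)
open import Data.Sum using (_⊎_; inj₁; inj₂)
open import Data.Empty using (⊥-elim)
open import Relation.Nullary using (¬_; yes; no)
open import Relation.Binary.PropositionalEquality
open import Function using (id; _∘_; case_of_)

-- Read the parsing from right to left, keeping o = number of ones in the
-- current suffix.  The suffix has at most 3o + 2 phrases, at most 3o if it
-- starts with a 1, and at most 3o + 1 if it starts with a 0 preceded by a 0.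
-- A phrase containing a 1 costs at most 3 and consumes a 1.  An all-zero
-- phrase preceded by a 0 cannot be followed by a 0: shifted one position to
-- the left, the zero run would be a longer previous occurrence.  So it is
-- followed by a 1 or by the end of the string, which is what the three
-- bounds need.

bit : Bool → ℕ
bit b = if b then 1 else 0

module _ {n : ℕ} (X : Fin n → Bool) where

  -- X extended by 0 beyond its end, so that positions are plain numbers.
  charAt : ℕ → Bool
  charAt k with k <? n
  ... | yes k<n = X (fromℕ< k<n)
  ... | no _    = false

  charAt-fromℕ< : ∀ {k} (k<n : k < n) → X (fromℕ< k<n) ≡ charAt k
  charAt-fromℕ< {k} k<n with k <? n
  ... | yes _    = refl
  ... | no k≮n = ⊥-elim (k≮n k<n)

  onesIn : ℕ → ℕ → ℕ
  onesIn i zero    = 0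
  onesIn i (suc ℓ) = bit (charAt i) + onesIn (suc i) ℓ

  onesIn-+ : ∀ i d e → onesIn i (d + e) ≡ onesIn i d + onesIn (i + d) e
  onesIn-+ i zero    e rewrite +-identityʳ i = refl
  onesIn-+ i (suc d) e rewrite onesIn-+ (suc i) d e | +-suc i d =
    sym (+-assoc (bit (charAt i)) (onesIn (suc i) d) _)

  onesFrom : ℕ → ℕ
  onesFrom i = onesIn i (n ∸ i)

  onesFrom-split : ∀ i ℓ → i + ℓ ≤ n → onesFrom i ≡ onesIn i ℓ + onesFrom (i + ℓ)
  onesFrom-split i ℓ i+ℓ≤n = begin
    onesIn i (n ∸ i)                          ≡⟨ cong (onesIn i) (sym (m+[n∸m]≡n ℓ≤n∸i)) ⟩
    onesIn i (ℓ + (n ∸ i ∸ ℓ))                ≡⟨ onesIn-+ i ℓ _ ⟩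
    onesIn i ℓ + onesIn (i + ℓ) (n ∸ i ∸ ℓ)   ≡⟨ cong (λ t → onesIn i ℓ + onesIn (i + ℓ) t) (∸-+-assoc n i ℓ) ⟩
    onesIn i ℓ + onesFrom (i + ℓ)             ∎
    where
    open ≡-Reasoning
    ℓ≤n∸i : ℓ ≤ n ∸ i
    ℓ≤n∸i = subst (_≤ n ∸ i) (m+n∸m≡n i ℓ) (∸-monoˡ-≤ i i+ℓ≤n)

  sum-tabulate-onesIn : ∀ m (h : Fin m → ℕ) i → (∀ j → h j ≡ bit (charAt (i + toℕ j))) →
                        sum (tabulate h) ≡ onesIn i m
  sum-tabulate-onesIn zero    h i h≗ = refl
  sum-tabulate-onesIn (suc m) h i h≗ = cong₂ _+_
    (trans (h≗ Fin.zero) (cong (bit ∘ charAt) (+-identityʳ i)))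
    (sum-tabulate-onesIn m (h ∘ Fin.suc) (suc i)
      (λ j → trans (h≗ (Fin.suc j)) (cong (bit ∘ charAt) (+-suc i (toℕ j)))))
    where import Data.Fin as Fin

  ones≡onesFrom0 : ones X ≡ onesFrom 0
  ones≡onesFrom0 = trans (cong sum (map-tabulate id (bit ∘ X)))
    (sum-tabulate-onesIn n (bit ∘ X) 0 λ j →
      cong bit (trans (cong X (sym (fromℕ<-toℕ j (toℕ<n j)))) (charAt-fromℕ< (toℕ<n j))))

  ZeroRun : ℕ → ℕ → Set
  ZeroRun i ℓ = ∀ k → k < ℓ → charAt (i + k) ≡ false

  ZeroRun-cons : ∀ {i ℓ} → charAt i ≡ false → ZeroRun (suc i) ℓ → ZeroRun i (suc ℓ)
  ZeroRun-cons {i} x≡0 run zero    _         = trans (cong charAt (+-identityʳ i)) x≡0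
  ZeroRun-cons {i} x≡0 run (suc k) (s≤s k<ℓ) = trans (cong charAt (+-suc i k)) (run k k<ℓ)

  onesIn≡0⇒ZeroRun : ∀ i ℓ → onesIn i ℓ ≡ 0 → ZeroRun i ℓ
  onesIn≡0⇒ZeroRun i zero    _    = λ _ ()
  onesIn≡0⇒ZeroRun i (suc ℓ) none with charAt i in x≡ | none
  ... | false | rest = ZeroRun-cons x≡ (onesIn≡0⇒ZeroRun (suc i) ℓ rest)

  ZeroRun-snoc : ∀ {i ℓ} → ZeroRun i ℓ → charAt (i + ℓ) ≡ false → ZeroRun i (suc ℓ)
  ZeroRun-snoc run x≡0 k (s≤s k≤ℓ) with m≤n⇒m<n∨m≡n k≤ℓ
  ... | inj₁ k<ℓ  = run k k<ℓ
  ... | inj₂ refl = x≡0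

  PrevOcc-intro : ∀ {i i′ ℓ} → i + ℓ ≤ n → i′ < i →
                  (∀ k → k < ℓ → charAt (i′ + k) ≡ charAt (i + k)) → PrevOcc X i ℓ
  PrevOcc-intro i+ℓ≤n i′<i same = i+ℓ≤n , _ , i′<i , λ k k<ℓ p q →
    trans (charAt-fromℕ< p) (trans (same k k<ℓ) (sym (charAt-fromℕ< q)))

  LZ77-start≤n : ∀ {i z} → LZ77 X i z → i ≤ n
  LZ77-start≤n lz-end                = ≤-refl
  LZ77-start≤n (lz-step (i<n , _) _) = <⇒≤ i<n

  LZ77-empty⊎start<n : ∀ {i z} → LZ77 X i z → z ≡ 0 ⊎ i < n
  LZ77-empty⊎start<n lz-end                = inj₁ refl
  LZ77-empty⊎start<n (lz-step (i<n , _) _) = inj₂ i<n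

  onesFrom-beforeParse : ∀ {i ℓ z c} → LZ77 X (i + ℓ) z → onesIn i ℓ ≡ c →
                         onesFrom i ≡ c + onesFrom (i + ℓ)
  onesFrom-beforeParse {i} {ℓ} rest refl = onesFrom-split i ℓ (LZ77-start≤n rest)

  LZPhrase-nonempty : ∀ {i ℓ} → LZPhrase X i ℓ → 1 ≤ ℓ
  LZPhrase-nonempty (_ , inj₁ (1≤ℓ , _))  = 1≤ℓ
  LZPhrase-nonempty (_ , inj₂ (refl , _)) = s≤s z≤n

  LZPhrase-longest : ∀ {i ℓ m} → LZPhrase X i ℓ → PrevOcc X i m → 1 ≤ m → m ≤ ℓ
  LZPhrase-longest (_ , inj₁ (_ , _ , longest)) occ _   = longest _ occ
  LZPhrase-longest (_ , inj₂ (_ , noOcc))       occ 1≤m = ⊥-elim (noOcc _ 1≤m occ)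

  zeroPhrase-notFollowedByZero : ∀ {i₀ ℓ} → LZPhrase X (suc i₀) ℓ →
    charAt i₀ ≡ false → ZeroRun (suc i₀) ℓ → suc i₀ + ℓ < n → ¬ charAt (suc i₀ + ℓ) ≡ false
  zeroPhrase-notFollowedByZero {i₀} {ℓ} phrase x₀≡0 run end<n xj≡0 =
    <-irrefl refl (LZPhrase-longest phrase occ (s≤s z≤n))
    where
    longer : ZeroRun (suc i₀) (suc ℓ)
    longer = ZeroRun-snoc run xj≡0
    occ : PrevOcc X (suc i₀) (suc ℓ)
    occ = PrevOcc-intro (subst (_≤ n) (sym (+-suc (suc i₀) ℓ)) end<n) ≤-refl
      λ k k<1+ℓ → trans (ZeroRun-cons x₀≡0 run k k<1+ℓ) (sym (longer k k<1+ℓ))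

  record Bound (i z : ℕ) : Set where
    field
      general   : z ≤ 2 + 3 * onesFrom i
      atOne     : charAt i ≡ true → z ≤ 3 * onesFrom i
      afterZero : ∀ {i₀} → i ≡ suc i₀ → charAt i₀ ≡ false → charAt i ≡ false →
                  z ≤ 1 + 3 * onesFrom i
  open Bound

  Bound-tight : ∀ {i z} → z ≤ 3 * onesFrom i → Bound i z
  Bound-tight z≤ = record
    { general   = ≤-trans z≤ (m≤n+m _ 2)
    ; atOne     = λ _ → z≤
    ; afterZero = λ _ _ _ → ≤-trans z≤ (m≤n+m _ 1)
    }

  Bound-end : Bound n 0
  Bound-end = Bound-tight z≤n

  suc≤3*[1+c+b] : ∀ {z c b a} → z ≤ 2 + 3 * b → a ≡ suc c + b → suc z ≤ 3 * a
  suc≤3*[1+c+b] {z} {c} {b} z≤ refl = begin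
    suc z             ≤⟨ s≤s z≤ ⟩
    3 + 3 * b         ≤⟨ +-monoˡ-≤ (3 * b) (*-monoʳ-≤ 3 {1} {suc c} (s≤s z≤n)) ⟩
    3 * suc c + 3 * b ≡⟨ *-distribˡ-+ 3 (suc c) b ⟨
    3 * (suc c + b)   ∎
    where open ≤-Reasoning

  Bound-precededByZero : ∀ {i₀ z} → Bound (suc i₀) z → charAt i₀ ≡ false →
                         z ≤ 1 + 3 * onesFrom (suc i₀)
  Bound-precededByZero {i₀} bound x₀≡0 with charAt (suc i₀) in x≡
  ... | true  = ≤-trans (atOne bound x≡) (m≤n+m _ 1)
  ... | false = afterZero bound refl x₀≡0 x≡

  zeroPhrase-precededByZero : ∀ {i₀ ℓ z} → LZPhrase X (suc i₀) ℓ → LZ77 X (suc i₀ + ℓ) z →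
    ZeroRun (suc i₀) ℓ → charAt i₀ ≡ false → Bound (suc i₀ + ℓ) z →
    suc z ≤ 1 + 3 * onesFrom (suc i₀ + ℓ)
  zeroPhrase-precededByZero {i₀} {ℓ} phrase rest run x₀≡0 next with charAt (suc i₀ + ℓ) in x≡
  ... | true = s≤s (atOne next x≡)
  ... | false with LZ77-empty⊎start<n rest
  ...   | inj₁ refl = s≤s z≤n
  ...   | inj₂ end<n  = ⊥-elim (zeroPhrase-notFollowedByZero phrase x₀≡0 run end<n x≡)

  zeroPhrase-Bound : ∀ {i ℓ z} → LZPhrase X i (suc ℓ) → LZ77 X (i + suc ℓ) z →
    ZeroRun i (suc ℓ) → onesFrom i ≡ onesFrom (i + suc ℓ) → Bound (i + suc ℓ) z → Bound i (suc z)
  zeroPhrase-Bound {i} {ℓ} {z} phrase rest run same next = record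
    { general   = subst (λ o → suc z ≤ 2 + 3 * o) (sym same) (s≤s afterLast)
    ; atOne     = λ x≡1 → case (trans (sym x≡1) x≡0) of λ ()
    ; afterZero = λ { refl x₀≡0 _ → subst (λ o → suc z ≤ 1 + 3 * o) (sym same)
                                          (zeroPhrase-precededByZero phrase rest run x₀≡0 next) }
    }
    where
    x≡0 : charAt i ≡ false
    x≡0 = trans (cong charAt (sym (+-identityʳ i))) (run 0 (s≤s z≤n))
    afterLast : z ≤ 1 + 3 * onesFrom (i + suc ℓ)
    afterLast rewrite +-suc i ℓ = Bound-precededByZero next (run ℓ ≤-refl)

  phrase-Bound : ∀ {i ℓ z} → LZPhrase X i ℓ → LZ77 X (i + ℓ) z → Bound (i + ℓ) z → Bound i (suc z)
  phrase-Bound {ℓ = zero} phrase _ _ with LZPhrase-nonempty phrase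
  ... | ()
  phrase-Bound {i} {suc ℓ} phrase rest next with onesIn i (suc ℓ) in onesIn≡
  ... | suc c = Bound-tight (suc≤3*[1+c+b] {c = c} (general next) (onesFrom-beforeParse rest onesIn≡))
  ... | zero  = zeroPhrase-Bound phrase rest (onesIn≡0⇒ZeroRun i (suc ℓ) onesIn≡)
                                 (onesFrom-beforeParse rest onesIn≡) next

  LZ77-Bound : ∀ {i z} → LZ77 X i z → Bound i z
  LZ77-Bound lz-end                = Bound-end
  LZ77-Bound (lz-step phrase rest) = phrase-Bound phrase rest (LZ77-Bound rest)

lemma7p4 : (n : ℕ) (f : Fin n → Bool) (z : ℕ) →
    LZ77Size f z → z ≤ 3 * ones f + 2
lemma7p4 n f z parse = begin
  z                       ≤⟨ Bound.general (LZ77-Bound f parse) ⟩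
  2 + 3 * onesFrom f 0    ≡⟨ +-comm 2 _ ⟩
  3 * onesFrom f 0 + 2    ≡⟨ cong (λ o → 3 * o + 2) (ones≡onesFrom0 f) ⟨
  3 * ones f + 2          ∎
  where open ≤-Reasoning
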